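{- Let $N$ be an integer and set $b=\lfloor\sqrt N\rfloor-1$, and assume $1<b<N$ and $\gcd(N,b)=1$. Let $x,y$ be the unique integers with $N=bx+y$ and $0\le y<b$, and let $A=(0,0)$, $B=(1,b)$, $C=(x+1,b-y)$. Then $AB$ is a shortest edge of the triangle $ABC$, i.e. $\|AB\|\le\|BC\|$ and $\|AB\|\le\|AC\|$.
   Context: $\|\cdot\|$ is the Euclidean norm; $AB=(1,b)$, $AC=(x+1,b-y)$, $BC=(x,-y)$. The triangle $ABC$ is formed by points of the modular lattice $L_{N,1,b}=\{(n \bmod N,\ nb \bmod N):0\le n<N\}$. -}

module Defs where

open import Data.Nat using (ℕ; _*_; _≤_; _<_; suc)
open import Data.Integer as ℤ using (ℤ)
open import Data.Product using (_×_; _,_)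

IsFloorSqrt : ℕ → ℕ → Set
IsFloorSqrt r N = (r * r ≤ N) × (N < suc r * suc r)

Point : Set
Point = ℤ × ℤ

vec : Point → Point → Point
vec (p₁ , p₂) (q₁ , q₂) = (q₁ ℤ.- p₁ , q₂ ℤ.- p₂)

-- Squared Euclidean norm ‖v‖².  Since norms are ≥ 0, ‖u‖ ≤ ‖v‖ ⇔ ‖u‖² ≤ ‖v‖².
normSq : Point → ℤ
normSq (v₁ , v₂) = v₁ ℤ.* v₁ ℤ.+ v₂ ℤ.* v₂

module Submission where

open import Defs
open import Data.Nat using (ℕ; suc; _+_; _*_; _<_; _≤_; z≤n)
open import Data.Nat.GCD using (gcd)
open import Data.Integer as ℤ using (ℤ; +_)
open import Data.Product using (_×_; _,_)
open import Relation.Binary.PropositionalEquality using (_≡_; refl; sym; trans; cong; cong₂; subst)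
import Data.Nat.Properties as ℕₚ
import Data.Integer.Properties as ℤₚ
open import Algebra.Properties.AbelianGroup ℤₚ.+-0-abelianGroup using (//-rightDividesʳ)

-- Since N ≥ (b+1)² and y < b, the quotient x = N div b is at least b+1.  The first
-- coordinates of BC and AC are x and x+1, so their squares alone exceed ‖AB‖² = 1 + b².

quotient-small : ∀ {b x y} → x ≤ b → y < b → b * x + y < suc b * suc b
quotient-small {b} {x} {y} x≤b y<b = begin-strict
  b * x + y  ≤⟨ ℕₚ.+-monoˡ-≤ y (ℕₚ.*-monoʳ-≤ b x≤b) ⟩
  b * b + y  <⟨ ℕₚ.+-monoʳ-< (b * b) y<b ⟩
  b * b + b  ≡⟨ ℕₚ.+-comm (b * b) b ⟩
  b + b * b  ≡⟨ ℕₚ.*-suc b b ⟨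
  b * suc b  <⟨ ℕₚ.*-monoˡ-< (suc b) (ℕₚ.n<1+n b) ⟩
  suc b * suc b ∎
  where open ℕₚ.≤-Reasoning

quotient-large : ∀ {b x y} → suc b * suc b ≤ b * x + y → y < b → suc b ≤ x
quotient-large [1+b]²≤N y<b = ℕₚ.≰⇒> λ x≤b → ℕₚ.<⇒≱ (quotient-small x≤b y<b) [1+b]²≤N

suc-square<square : ∀ {n m} → n < m → suc (n * n) ≤ m * m
suc-square<square n<m = ℕₚ.*-mono-< n<m n<m

square-nonNegative : ∀ i → ℤ.0ℤ ℤ.≤ i ℤ.* i
square-nonNegative (+ n)       = subst (ℤ.0ℤ ℤ.≤_) (ℤₚ.pos-* n n) (ℤ.+≤+ z≤n)
square-nonNegative ℤ.-[1+ n ] = ℤ.+≤+ z≤n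

square-≤-normSq : ∀ n v → + (n * n) ℤ.≤ normSq (+ n , v)
square-≤-normSq n v = subst (ℤ._≤ normSq (+ n , v)) (sym (ℤₚ.pos-* n n))
  (ℤₚ.i≤i+j (+ n ℤ.* + n) (v ℤ.* v) {{ℤ.nonNegative (square-nonNegative v)}})

vec-origin : ∀ P → vec (+ 0 , + 0) P ≡ P
vec-origin (p₁ , p₂) = cong₂ _,_ (ℤₚ.+-identityʳ p₁) (ℤₚ.+-identityʳ p₂)

normSq-1,b : ∀ b → normSq (+ 1 , + b) ≡ + (1 + b * b)
normSq-1,b b = cong (ℤ._+_ (+ 1)) (sym (ℤₚ.pos-* b b))

lemma3p4 : (N b x y : ℕ) →
    IsFloorSqrt (b + 1) N →
    1 < b → b < N → gcd N b ≡ 1 →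
    N ≡ b * x + y → y < b →
    let A = (+ 0 , + 0)
        B = (+ 1 , + b)
        C = (+ x ℤ.+ + 1 , + b ℤ.- + y)
    in (normSq (vec A B) ℤ.≤ normSq (vec B C)) × (normSq (vec A B) ℤ.≤ normSq (vec A C))
lemma3p4 _ b x y ([1+b]²≤N , _) _ _ _ refl y<b = AB≤BC , AB≤AC
  where
  open ℤₚ.≤-Reasoning
  c₂ : ℤ
  c₂ = + b ℤ.- + y

  A B C : Point
  A = (+ 0 , + 0)
  B = (+ 1 , + b)
  C = (+ x ℤ.+ + 1 , c₂)

  b<x : b < x
  b<x = quotient-large (subst (λ t → t * t ≤ b * x + y) (ℕₚ.+-comm b 1) [1+b]²≤N) y<b

  ‖AB‖² : normSq (vec A B) ≡ + (1 + b * b)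
  ‖AB‖² = trans (cong normSq (vec-origin B)) (normSq-1,b b)

  AB≤BC : normSq (vec A B) ℤ.≤ normSq (vec B C)
  AB≤BC = begin
    normSq (vec A B)           ≡⟨ ‖AB‖² ⟩
    + (1 + b * b)              ≤⟨ ℤ.+≤+ (suc-square<square b<x) ⟩
    + (x * x)                  ≤⟨ square-≤-normSq x (c₂ ℤ.- + b) ⟩
    normSq (+ x , c₂ ℤ.- + b)  ≡⟨ cong (λ u → normSq (u , c₂ ℤ.- + b)) (//-rightDividesʳ (+ 1) (+ x)) ⟨
    normSq (vec B C)           ∎

  AB≤AC : normSq (vec A B) ℤ.≤ normSq (vec A C)
  AB≤AC = begin
    normSq (vec A B)         ≡⟨ ‖AB‖² ⟩
    + (1 + b * b)            ≤⟨ ℤ.+≤+ (suc-square<square (ℕₚ.m≤n⇒m≤n+o 1 b<x)) ⟩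
    + ((x + 1) * (x + 1))    ≤⟨ square-≤-normSq (x + 1) c₂ ⟩
    normSq C                 ≡⟨ cong normSq (vec-origin C) ⟨
    normSq (vec A C)         ∎
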